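{- Let $\sigma$ be an ordered set partition of $[n]$ and let $\pi(\sigma)$ be the permutation defined in the context. Then $\mathrm{maj}$ achieves a unique minimum value on $S(\sigma)$, and this value is achieved at $\pi(\sigma)$. In particular $\mathrm{minimaj}(\sigma)=\mathrm{maj}(\pi(\sigma))$.
   Context: An ordered set partition of $[n]$ is a sequence $\sigma=(B_1|\dots|B_k)$ of nonempty pairwise disjoint subsets with union $[n]$. $S(\sigma)$ is the set of permutations (one-line notation) obtained by writing the blocks in order with letters within each block in any order. $\mathrm{maj}(w)=\sum_{p:w_p>w_{p+1}}p$ and $\mathrm{minimaj}(\sigma)=\min\{\mathrm{maj}(\pi):\pi\in S(\sigma)\}$. Definition of $\pi(\sigma)=\pi[1]\pi[2]\cdots\pi[k]$ (concatenation of segments): write $B_i=\{j^{(i)}_1<\cdots<j^{(i)}_{\alpha_i}\}$. Let $\pi[k]=j^{(k)}_1\cdots j^{(k)}_{\alpha_k}$. For $i=k-1,\dots,1$, once $\pi[i+1]$ is defined, let $r$ be its first letter and let $0\le m\le\alpha_i$ be maximal with $j^{(i)}_m\le r$ (where $j^{(i)}_0=-\infty$), and set $\pi[i]=j^{(i)}_{m+1}\cdots j^{(i)}_{\alpha_i}j^{(i)}_1\cdots j^{(i)}_m$. -}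

module Defs where

open import Data.Nat using (ℕ; zero; suc; _+_; _<_; _≤_; _<?_; _≤?_)
open import Data.List using (List; []; _∷_; _++_; concat; filter; applyUpTo)
open import Data.List.Relation.Unary.All using (All)
open import Data.List.Relation.Unary.Linked using (Linked)
open import Data.List.Relation.Binary.Permutation.Propositional using (_↭_)
open import Data.List.Relation.Binary.Pointwise using (Pointwise)
open import Data.Product using (Σ; _×_)
open import Relation.Binary.PropositionalEquality using (_≡_; _≢_)
open import Relation.Nullary.Decidable using (does)
open import Data.Bool using (if_then_else_)

[_] : ℕ → List ℕ
[ n ] = applyUpTo suc n

-- A block (a finite set of positive integers) is represented by the
-- strictly increasing list of its elements.  An ordered set partition
-- (B₁|…|Bₖ) is the list of its blocks, in order.
Block : Set
Block = List ℕ

-- σ is an ordered set partition of [n]: every block is a set (strictly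
-- increasing list), every block is nonempty, and the blocks are pairwise
-- disjoint with union [n] (equivalently: their concatenation is a
-- rearrangement of 1 2 … n).
record IsOSP (n : ℕ) (σ : List Block) : Set where
  field
    sorted   : All (Linked _<_) σ
    nonempty : All (λ B → B ≢ []) σ
    covers   : concat σ ↭ [ n ]

_∈S_ : List ℕ → List Block → Set
w ∈S σ = Σ (List (List ℕ)) (λ ws → Pointwise _↭_ ws σ × w ≡ concat ws)

-- maj(w) = Σ_{p : w_p > w_{p+1}} p  (positions 1-indexed)
majFrom : ℕ → List ℕ → ℕ
majFrom p (x ∷ y ∷ rest) = (if does (y <? x) then p else 0) + majFrom (suc p) (y ∷ rest)
majFrom p _ = 0

maj : List ℕ → ℕ
maj = majFrom 1

πσ : List Block → List ℕ
πσ [] = []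
πσ (B ∷ Bs) with πσ Bs
... | []    = B
... | r ∷ rest = (filter (λ x → r <? x) B ++ filter (λ x → x ≤? r) B) ++ (r ∷ rest)

-- Cut w ∈ S(σ) into its segments u₁ ⋯ uₖ.  Then maj w is a sum over i of the descents of uᵢ
-- followed by the first letter t of uᵢ₊₁, counted from the position p where uᵢ starts.  If
-- m ≥ 1 letters of uᵢ exceed t, this part is at least p + m − 1, since the last of those
-- letters is followed by a smaller one; π[i] = (letters > t)(letters ≤ t), both increasing,
-- is the only arrangement attaining the bound.  As t itself depends on the later segments,
-- the induction runs from the last block with a stronger hypothesis: a tail whose first
-- letter exceeds that of π's tail costs at least its starting position more, which outweighs
-- the boundary descent π[i] may pay (at a position below that start).

module Submission where

open import Defs
open import Data.Nat using (ℕ; zero; suc; _+_; _≤_; _<_; z≤n; s≤s; s≤s⁻¹; _<?_; _≤?_)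
open import Data.Nat.Properties
open import Data.List using (List; []; _∷_; _++_; _∷ʳ_; concat; filter; length)
open import Data.List.Properties
  using ( ++-assoc; ++-identityʳ; ++-conicalʳ; ∷-injectiveˡ
        ; filter-accept; filter-reject; filter-all; filter-none; filter-some; length-filter )
open import Data.List.Membership.Propositional using (_∈_)
open import Data.List.Membership.Propositional.Properties using (∈-++⁺ˡ; ∈-++⁺ʳ)
open import Data.List.Relation.Unary.All as All using (All; []; _∷_)
open import Data.List.Relation.Unary.All.Properties using (all-filter)
import Data.List.Relation.Unary.Any as Any
open import Data.List.Relation.Unary.Any using (here; there)
open import Data.List.Relation.Unary.Linked as Linked using (Linked; []; [-]; _∷_)
import Data.List.Relation.Unary.Linked.Properties as Linked
open import Data.List.Relation.Unary.Sorted.TotalOrder.Properties using (↗↭↗⇒≋)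
open import Data.List.Relation.Binary.Pointwise using (Pointwise; []; _∷_; Pointwise-≡⇒≡)
open import Data.List.Relation.Binary.Permutation.Propositional
  using (_↭_; ↭-refl; ↭-sym; ↭-trans; prep; ↭⇒↭ₛ)
open import Data.List.Relation.Binary.Permutation.Propositional.Properties
  using (↭-length; ↭-empty-inv; filter-↭; shift; ¬x∷xs↭[]; ∈-resp-↭)
open import Data.List.Relation.Binary.Sublist.Propositional using (⊆-refl)
import Data.List.Relation.Binary.Sublist.Propositional.Properties as Sublist
open import Data.List.Relation.Binary.Sublist.Heterogeneous.Properties using (length-mono-≤)
open import Data.Product using (_×_; _,_; proj₂; ∃₂)
open import Data.Sum using (_⊎_; inj₁; inj₂)
open import Data.Empty using (⊥; ⊥-elim)
open import Data.Bool using (if_then_else_)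
open import Function using (_∘_)
open import Relation.Nullary using (yes; no; does; contradiction)
open import Relation.Nullary.Decidable using (dec-true; dec-false)
open import Relation.Binary.PropositionalEquality
  using (_≡_; _≢_; refl; sym; trans; cong; cong₂; subst; subst₂; module ≡-Reasoning)

+-≤-squeeze : ∀ {a b c d} → a ≤ b → c ≤ d → b + d ≤ a + c → b ≤ a × d ≤ c
+-≤-squeeze {a} {b} {c} {d} a≤b c≤d bd≤ac =
  +-cancelʳ-≤ d b a (≤-trans bd≤ac (+-monoʳ-≤ a c≤d)) ,
  +-cancelˡ-≤ b d c (≤-trans bd≤ac (+-monoˡ-≤ c a≤b))

majFrom-desc : ∀ p {x y} w → y < x → majFrom p (x ∷ y ∷ w) ≡ p + majFrom (suc p) (y ∷ w)
majFrom-desc p {x} {y} w y<x rewrite dec-true (y <? x) y<x = refl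

majFrom-asc : ∀ p {x y} w → x ≤ y → majFrom p (x ∷ y ∷ w) ≡ majFrom (suc p) (y ∷ w)
majFrom-asc p {x} {y} w x≤y rewrite dec-false (y <? x) (≤⇒≯ x≤y) = refl

majFrom-∷∷≤ : ∀ p x y w → majFrom p (x ∷ y ∷ w) ≤ p + majFrom (suc p) (y ∷ w)
majFrom-∷∷≤ p x y w with y <? x
... | yes y<x = ≤-reflexive (majFrom-desc p w y<x)
... | no y≮x = ≤-trans (≤-reflexive (majFrom-asc p w (≮⇒≥ y≮x))) (m≤n+m _ p)

majFrom-∷ : ∀ p x w → majFrom (suc p) w ≤ majFrom p (x ∷ w)
majFrom-∷ p x [] = z≤n
majFrom-∷ p x (y ∷ w) = m≤n+m _ _

segmentMaj : ℕ → List ℕ → ℕ → ℕ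
segmentMaj p u t = majFrom p (u ∷ʳ t)

majFrom-++ : ∀ p u y w → majFrom p (u ++ y ∷ w) ≡ segmentMaj p u y + majFrom (p + length u) (y ∷ w)
majFrom-++ p [] y w = cong (λ q → majFrom q (y ∷ w)) (sym (+-identityʳ p))
majFrom-++ p (x ∷ []) y w =
  cong₂ _+_ (sym (+-identityʳ _)) (cong (λ q → majFrom q (y ∷ w)) (+-comm 1 p))
majFrom-++ p (x ∷ x′ ∷ u) y w = begin
  d + majFrom (suc p) (x′ ∷ u ++ y ∷ w)
    ≡⟨ cong (d +_) (majFrom-++ (suc p) (x′ ∷ u) y w) ⟩
  d + (segmentMaj (suc p) (x′ ∷ u) y + majFrom (suc p + length (x′ ∷ u)) (y ∷ w))
    ≡⟨ sym (+-assoc d _ _) ⟩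
  d + segmentMaj (suc p) (x′ ∷ u) y + majFrom (suc p + length (x′ ∷ u)) (y ∷ w)
    ≡⟨ cong (λ q → d + segmentMaj (suc p) (x′ ∷ u) y + majFrom q (y ∷ w)) (sym (+-suc p _)) ⟩
  d + segmentMaj (suc p) (x′ ∷ u) y + majFrom (p + length (x ∷ x′ ∷ u)) (y ∷ w) ∎
  where
  open ≡-Reasoning
  d = if does (x′ <? x) then p else 0

sorted⇒majFrom≡0 : ∀ p {w} → Linked _≤_ w → majFrom p w ≡ 0
sorted⇒majFrom≡0 p [] = refl
sorted⇒majFrom≡0 p [-] = refl
sorted⇒majFrom≡0 p {x ∷ y ∷ w} (x≤y ∷ w↗) =
  trans (majFrom-asc p w x≤y) (sorted⇒majFrom≡0 (suc p) w↗)

sorted⊎p≤majFrom : ∀ p w → Linked _≤_ w ⊎ p ≤ majFrom p w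
sorted⊎p≤majFrom p [] = inj₁ []
sorted⊎p≤majFrom p (x ∷ []) = inj₁ [-]
sorted⊎p≤majFrom p (x ∷ y ∷ w) with y <? x | sorted⊎p≤majFrom (suc p) (y ∷ w)
... | yes y<x | _ = inj₂ (subst (p ≤_) (sym (majFrom-desc p w y<x)) (m≤m+n p _))
... | no y≮x | inj₁ yw↗ = inj₁ (≮⇒≥ y≮x ∷ yw↗)
... | no y≮x | inj₂ p<maj =
  inj₂ (subst (p ≤_) (sym (majFrom-asc p w (≮⇒≥ y≮x))) (≤-trans (n≤1+n p) p<maj))

majFrom<p⇒sorted : ∀ p w → majFrom p w < p → Linked _≤_ w
majFrom<p⇒sorted p w maj<p with sorted⊎p≤majFrom p w
... | inj₁ w↗ = w↗
... | inj₂ p≤maj = contradiction p≤maj (<⇒≱ maj<p)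

inversion⇒p≤majFrom : ∀ p {x y w} → y ∈ w → y < x → p ≤ majFrom p (x ∷ w)
inversion⇒p≤majFrom p {x} {w = w} y∈w y<x with sorted⊎p≤majFrom p (x ∷ w)
... | inj₂ p≤maj = p≤maj
... | inj₁ xw↗ =
  contradiction (All.lookup (Linked.Linked⇒All ≤-trans ≤-refl xw↗) (there y∈w)) (<⇒≱ y<x)

majFrom-sorted-++-sorted : ∀ p {x} xs {ys} → Linked _≤_ (x ∷ xs) → Linked _≤_ ys →
                           majFrom p (x ∷ xs ++ ys) ≤ p + length xs
majFrom-sorted-++-sorted p [] {[]} _ _ = z≤n
majFrom-sorted-++-sorted p {x} [] {y ∷ ys} _ ys↗ =
  ≤-trans (majFrom-∷∷≤ p x y ys) (≤-reflexive (cong (p +_) (sorted⇒majFrom≡0 (suc p) ys↗)))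
majFrom-sorted-++-sorted p {x} (x′ ∷ xs) {ys} (x≤x′ ∷ xs↗) ys↗ = begin
  majFrom p (x ∷ x′ ∷ xs ++ ys)     ≡⟨ majFrom-asc p (xs ++ ys) x≤x′ ⟩
  majFrom (suc p) (x′ ∷ xs ++ ys)   ≤⟨ majFrom-sorted-++-sorted (suc p) xs xs↗ ys↗ ⟩
  suc p + length xs                 ≡⟨ sym (+-suc p _) ⟩
  p + length (x′ ∷ xs)              ∎
  where open ≤-Reasoning

↗↭↗⇒≡ : ∀ {xs ys} → Linked _≤_ xs → Linked _≤_ ys → xs ↭ ys → xs ≡ ys
↗↭↗⇒≡ xs↗ ys↗ xs↭ys = Pointwise-≡⇒≡ (↗↭↗⇒≋ ≤-totalOrder xs↗ ys↗ (↭⇒↭ₛ xs↭ys))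

sorted-∷ʳ⁺ : ∀ {t u} → Linked _≤_ u → All (_≤ t) u → Linked _≤_ (u ∷ʳ t)
sorted-∷ʳ⁺ [] [] = [-]
sorted-∷ʳ⁺ [-] (x≤t ∷ []) = x≤t ∷ [-]
sorted-∷ʳ⁺ (x≤y ∷ u↗) (_ ∷ u≤t) = x≤y ∷ sorted-∷ʳ⁺ u↗ u≤t

sorted-∷ʳ⁻ : ∀ {t} u → Linked _≤_ (u ∷ʳ t) → Linked _≤_ u × All (_≤ t) u
sorted-∷ʳ⁻ [] _ = [] , []
sorted-∷ʳ⁻ (x ∷ []) (x≤t ∷ _) = [-] , x≤t ∷ []
sorted-∷ʳ⁻ (x ∷ y ∷ u) (x≤y ∷ yu↗) with sorted-∷ʳ⁻ (y ∷ u) yu↗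
... | yu↗′ , y≤t ∷ u≤t = x≤y ∷ yu↗′ , ≤-trans x≤y y≤t ∷ y≤t ∷ u≤t

-- With t the first letter of π[i+1], rotate t Bᵢ is the segment π[i].
above atMost rotate : ℕ → List ℕ → List ℕ
above t = filter (t <?_)
atMost t = filter (_≤? t)
rotate t B = above t B ++ atMost t B

#above : ℕ → List ℕ → ℕ
#above t u = length (above t u)

-- The least segmentMaj p u t over the arrangements u of a block with m letters above t.
minSegmentMaj : ℕ → ℕ → ℕ
minSegmentMaj p zero = 0
minSegmentMaj p (suc m) = p + m

above-∷-accept : ∀ {t z} u → t < z → above t (z ∷ u) ≡ z ∷ above t u
above-∷-accept {t} u = filter-accept (t <?_) {xs = u}

above-∷-reject : ∀ {t z} u → z ≤ t → above t (z ∷ u) ≡ above t u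
above-∷-reject {t} u z≤t = filter-reject (t <?_) {xs = u} (≤⇒≯ z≤t)

rotate-∷-above : ∀ {t z} u → t < z → rotate t (z ∷ u) ≡ z ∷ rotate t u
rotate-∷-above {t} u t<z =
  cong₂ _++_ (above-∷-accept u t<z) (filter-reject (_≤? t) {xs = u} (<⇒≱ t<z))

rotate-∷-atMost : ∀ {t z} u → z ≤ t → rotate t (z ∷ u) ≡ above t u ++ z ∷ atMost t u
rotate-∷-atMost {t} u z≤t =
  cong₂ _++_ (above-∷-reject u z≤t) (filter-accept (_≤? t) {xs = u} z≤t)

rotate-↭ : ∀ t u → rotate t u ↭ u
rotate-↭ t [] = ↭-refl
rotate-↭ t (z ∷ u) with t <? z
... | yes t<z = subst (_↭ z ∷ u) (sym (rotate-∷-above u t<z)) (prep z (rotate-↭ t u))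
... | no t≮z = subst (_↭ z ∷ u) (sym (rotate-∷-atMost u (≮⇒≥ t≮z)))
                 (↭-trans (shift z (above t u) (atMost t u)) (prep z (rotate-↭ t u)))

#above-↭ : ∀ t {u v} → u ↭ v → #above t u ≡ #above t v
#above-↭ t u↭v = ↭-length (filter-↭ (t <?_) u↭v)

#above-antitone : ∀ {s r} u → s ≤ r → #above r u ≤ #above s u
#above-antitone {s} {r} u s≤r =
  length-mono-≤ (Sublist.filter⁺ (r <?_) (s <?_) (λ { refl r<x → ≤-<-trans s≤r r<x })
                                 (⊆-refl {x = u}))

0<#above : ∀ {t y u} → y ∈ u → t < y → 0 < #above t u
0<#above {t} y∈u t<y = filter-some (t <?_) (Any.map (λ { refl → t<y }) y∈u)

minSegmentMaj-mono : ∀ p {m n} → m ≤ n → minSegmentMaj p m ≤ minSegmentMaj p n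
minSegmentMaj-mono p {zero} _ = z≤n
minSegmentMaj-mono p {suc m} {suc n} (s≤s m≤n) = +-monoʳ-≤ p m≤n

minSegmentMaj-suc : ∀ p m → minSegmentMaj p m ≤ minSegmentMaj (suc p) m
minSegmentMaj-suc p zero = z≤n
minSegmentMaj-suc p (suc m) = n≤1+n (p + m)

minSegmentMaj-pos : ∀ p {m} → 0 < m → minSegmentMaj (suc p) m ≡ p + m
minSegmentMaj-pos p {suc m} _ = sym (+-suc p m)

minSegmentMaj-< : ∀ p m → minSegmentMaj (suc p) m < suc p + m
minSegmentMaj-< p zero = s≤s z≤n
minSegmentMaj-< p (suc m) = +-monoʳ-< (suc p) (n<1+n m)

minSegmentMaj≤segmentMaj : ∀ p t u → minSegmentMaj p (#above t u) ≤ segmentMaj p u t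
minSegmentMaj≤segmentMaj p t [] = z≤n
minSegmentMaj≤segmentMaj p t (z ∷ u) with t <? z
... | no t≮z = begin
  minSegmentMaj p (#above t (z ∷ u))
    ≡⟨ cong (minSegmentMaj p ∘ length) (above-∷-reject u (≮⇒≥ t≮z)) ⟩
  minSegmentMaj p (#above t u)          ≤⟨ minSegmentMaj-suc p (#above t u) ⟩
  minSegmentMaj (suc p) (#above t u)    ≤⟨ minSegmentMaj≤segmentMaj (suc p) t u ⟩
  segmentMaj (suc p) u t                ≤⟨ majFrom-∷ p z (u ∷ʳ t) ⟩
  segmentMaj p (z ∷ u) t                ∎
  where open ≤-Reasoning
... | yes t<z = begin
  minSegmentMaj p (#above t (z ∷ u))    ≡⟨ cong (minSegmentMaj p ∘ length) (above-∷-accept u t<z) ⟩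
  p + #above t u                        ≤⟨ z-above (#above t u) (minSegmentMaj≤segmentMaj (suc p) t u) ⟩
  segmentMaj p (z ∷ u) t                ∎
  where
  open ≤-Reasoning
  z-above : ∀ m → minSegmentMaj (suc p) m ≤ segmentMaj (suc p) u t → p + m ≤ segmentMaj p (z ∷ u) t
  z-above zero _ = subst (_≤ segmentMaj p (z ∷ u) t) (sym (+-identityʳ p))
                     (inversion⇒p≤majFrom p (∈-++⁺ʳ u (here refl)) t<z)
  z-above (suc m) ih = subst (_≤ segmentMaj p (z ∷ u) t) (sym (+-suc p m))
                         (≤-trans ih (majFrom-∷ p z (u ∷ʳ t)))

-- One descent before y, at position ≥ p, and one after the last letter above t.
inversion-above⇒segmentMaj≥ : ∀ p {t x y} u → t < y → y < x → y ∈ u →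
                          p + (p + #above t u) ≤ segmentMaj p (x ∷ u) t
inversion-above⇒segmentMaj≥ p {t} {x} {y} (z ∷ u) t<y y<x y∈zu with z <? x
... | yes z<x = begin
  p + (p + #above t (z ∷ u))
    ≡⟨ cong (p +_) (minSegmentMaj-pos p (0<#above y∈zu t<y)) ⟨
  p + minSegmentMaj (suc p) (#above t (z ∷ u))
    ≤⟨ +-monoʳ-≤ p (minSegmentMaj≤segmentMaj (suc p) t (z ∷ u)) ⟩
  p + segmentMaj (suc p) (z ∷ u) t
    ≡⟨ majFrom-desc p (u ∷ʳ t) z<x ⟨
  segmentMaj p (x ∷ z ∷ u) t ∎
  where open ≤-Reasoning
... | no z≮x = begin
  p + (p + #above t (z ∷ u))                ≡⟨ cong (λ hi → p + (p + length hi)) (above-∷-accept u t<z) ⟩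
  p + (p + suc (#above t u))                ≡⟨ cong (p +_) (+-suc p _) ⟩
  p + suc (p + #above t u)                  ≤⟨ n≤1+n _ ⟩
  suc p + (suc p + #above t u)              ≤⟨ inversion-above⇒segmentMaj≥ (suc p) u t<y y<z y∈u ⟩
  segmentMaj (suc p) (z ∷ u) t              ≡⟨ majFrom-asc p (u ∷ʳ t) x≤z ⟨
  segmentMaj p (x ∷ z ∷ u) t                ∎
  where
  open ≤-Reasoning
  x≤z = ≮⇒≥ z≮x
  y<z = <-≤-trans y<x x≤z
  t<z = <-trans t<y y<z
  y∈u = Any.tail (<⇒≢ y<z) y∈zu

segmentMaj-rotate≤min : ∀ p t {B} → Linked _≤_ B →
                        segmentMaj p (rotate t B) t ≤ minSegmentMaj p (#above t B)
segmentMaj-rotate≤min p t {B} B↗ with above t B | Linked.filter⁺ (t <?_) ≤-trans B↗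
... | [] | _ = ≤-reflexive (sorted⇒majFrom≡0 p (sorted-∷ʳ⁺ lo↗ lo≤t))
  where
  lo↗ = Linked.filter⁺ (_≤? t) ≤-trans B↗
  lo≤t = all-filter (_≤? t) B
... | a ∷ hi | hi↗ = begin
  majFrom p ((a ∷ hi ++ atMost t B) ∷ʳ t)
    ≡⟨ cong (majFrom p) (++-assoc (a ∷ hi) (atMost t B) (t ∷ [])) ⟩
  majFrom p (a ∷ hi ++ atMost t B ∷ʳ t)
    ≤⟨ majFrom-sorted-++-sorted p hi hi↗ (sorted-∷ʳ⁺ lo↗ lo≤t) ⟩
  p + length hi ∎
  where
  open ≤-Reasoning
  lo↗ = Linked.filter⁺ (_≤? t) ≤-trans B↗
  lo≤t = all-filter (_≤? t) B

record IsRotation (t : ℕ) (u : List ℕ) : Set where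
  field
    rotation      : u ≡ rotate t u
    above-sorted  : Linked _≤_ (above t u)
    atMost-sorted : Linked _≤_ (atMost t u)

above-≡[] : ∀ {t} u → All (_≤ t) u → above t u ≡ []
above-≡[] {t} u u≤t = filter-none (t <?_) (All.map ≤⇒≯ u≤t)

sorted-∷ʳ⇒isRotation : ∀ {t} u → Linked _≤_ (u ∷ʳ t) → IsRotation t u
sorted-∷ʳ⇒isRotation {t} u ut↗ with sorted-∷ʳ⁻ u ut↗
... | u↗ , u≤t = record
  { rotation      = sym (cong₂ _++_ (above-≡[] u u≤t) (filter-all (_≤? t) u≤t))
  ; above-sorted  = Linked.filter⁺ (t <?_) ≤-trans u↗
  ; atMost-sorted = Linked.filter⁺ (_≤? t) ≤-trans u↗
  }

∷-isRotation : ∀ {t z u} → t < z → Linked _≤_ (z ∷ above t u) →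
               IsRotation t u → IsRotation t (z ∷ u)
∷-isRotation {t} {z} {u} t<z z∷hi↗ R = record
  { rotation      = trans (cong (z ∷_) (IsRotation.rotation R)) (sym (rotate-∷-above u t<z))
  ; above-sorted  = subst (Linked _≤_) (sym (above-∷-accept u t<z)) z∷hi↗
  ; atMost-sorted = subst (Linked _≤_) (sym (filter-reject (_≤? t) {xs = u} (<⇒≱ t<z)))
                          (IsRotation.atMost-sorted R)
  }

isRotation⇒≡rotate : ∀ {t u B} → u ↭ B → Linked _≤_ B → IsRotation t u → u ≡ rotate t B
isRotation⇒≡rotate {t} u↭B B↗ R = trans (IsRotation.rotation R) (cong₂ _++_
  (↗↭↗⇒≡ (IsRotation.above-sorted R) (Linked.filter⁺ (t <?_) ≤-trans B↗) (filter-↭ (t <?_) u↭B))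
  (↗↭↗⇒≡ (IsRotation.atMost-sorted R) (Linked.filter⁺ (_≤? t) ≤-trans B↗) (filter-↭ (_≤? t) u↭B)))

segmentMaj≤⇒head-above : ∀ p t z u {c} → #above t (z ∷ u) ≡ suc c →
                         segmentMaj (suc p) (z ∷ u) t ≤ suc p + c → t < z
segmentMaj≤⇒head-above p t z u {c} #≡ maj≤ with t <? z
... | yes t<z = t<z
... | no t≮z = contradiction (≤-trans lower maj≤) (<-irrefl refl)
  where
  #u≡ : #above t u ≡ suc c
  #u≡ = trans (sym (cong length (above-∷-reject u (≮⇒≥ t≮z)))) #≡
  lower : suc (suc p) + c ≤ segmentMaj (suc p) (z ∷ u) t
  lower = ≤-trans (subst (λ m → minSegmentMaj (suc (suc p)) m ≤ segmentMaj (suc (suc p)) u t) #u≡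
                         (minSegmentMaj≤segmentMaj (suc (suc p)) t u))
                  (majFrom-∷ (suc p) z (u ∷ʳ t))

segmentMaj≤⇒isRotation : ∀ p t u {c} → #above t u ≡ suc c →
                         segmentMaj (suc p) u t ≤ suc p + c → IsRotation t u
segmentMaj≤⇒isRotation p t (z ∷ u) {zero} #≡ maj≤ =
  ∷-isRotation t<z z∷hi↗ (sorted-∷ʳ⇒isRotation u ut↗)
  where
  t<z = segmentMaj≤⇒head-above p t z u #≡ maj≤
  ut↗ : Linked _≤_ (u ∷ʳ t)
  ut↗ = majFrom<p⇒sorted (suc (suc p)) (u ∷ʳ t)
          (s≤s (≤-trans (majFrom-∷ (suc p) z (u ∷ʳ t)) (≤-trans maj≤ (≤-reflexive (+-identityʳ (suc p))))))
  z∷hi↗ : Linked _≤_ (z ∷ above t u)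
  z∷hi↗ = subst (λ hi → Linked _≤_ (z ∷ hi)) (sym (above-≡[] u (proj₂ (sorted-∷ʳ⁻ u ut↗)))) [-]
segmentMaj≤⇒isRotation p t (z ∷ []) {suc c} #≡ maj≤ =
  contradiction (subst (_≤ 1) #≡ (length-filter (t <?_) (z ∷ []))) λ { (s≤s ()) }
segmentMaj≤⇒isRotation p t (z ∷ y ∷ u) {suc c} #≡ maj≤ = ∷-isRotation t<z z∷hi↗ R
  where
  t<z = segmentMaj≤⇒head-above p t z (y ∷ u) #≡ maj≤
  #yu≡ : #above t (y ∷ u) ≡ suc c
  #yu≡ = suc-injective (trans (sym (cong length (above-∷-accept (y ∷ u) t<z))) #≡)
  descent-too-costly : y < z → suc p + (suc (suc p) + c) ≤ segmentMaj (suc p) (z ∷ y ∷ u) t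
  descent-too-costly y<z = begin
    suc p + (suc (suc p) + c)
      ≡⟨ cong (λ m → suc p + minSegmentMaj (suc (suc p)) m) #yu≡ ⟨
    suc p + minSegmentMaj (suc (suc p)) (#above t (y ∷ u))
      ≤⟨ +-monoʳ-≤ (suc p) (minSegmentMaj≤segmentMaj (suc (suc p)) t (y ∷ u)) ⟩
    suc p + segmentMaj (suc (suc p)) (y ∷ u) t
      ≡⟨ majFrom-desc (suc p) (u ∷ʳ t) y<z ⟨
    segmentMaj (suc p) (z ∷ y ∷ u) t ∎
    where open ≤-Reasoning
  z≤y : z ≤ y
  z≤y = ≮⇒≥ λ y<z → <⇒≱ (s≤s (s≤s (m≤n+m c p)))
                      (+-cancelˡ-≤ (suc p) _ _ (≤-trans (descent-too-costly y<z) maj≤))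
  maj≤′ : segmentMaj (suc (suc p)) (y ∷ u) t ≤ suc (suc p) + c
  maj≤′ = subst₂ _≤_ (majFrom-asc (suc p) (u ∷ʳ t) z≤y) (+-suc (suc p) c) maj≤
  R = segmentMaj≤⇒isRotation (suc p) t (y ∷ u) #yu≡ maj≤′
  accept = above-∷-accept u (<-≤-trans t<z z≤y)
  z∷hi↗ : Linked _≤_ (z ∷ above t (y ∷ u))
  z∷hi↗ = subst (λ hi → Linked _≤_ (z ∷ hi)) (sym accept)
            (z≤y ∷ subst (Linked _≤_) accept (IsRotation.above-sorted R))

segmentMaj≤min⇒isRotation : ∀ p t u → segmentMaj (suc p) u t ≤ minSegmentMaj (suc p) (#above t u) →
                            IsRotation t u
segmentMaj≤min⇒isRotation p t u maj≤ with #above t u in #≡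
... | zero = sorted-∷ʳ⇒isRotation u (majFrom<p⇒sorted (suc p) (u ∷ʳ t) (s≤s (≤-trans maj≤ z≤n)))
... | suc c = segmentMaj≤⇒isRotation p t u #≡ maj≤

rotate-nonempty : ∀ r {x u B} → x ∷ u ↭ B → ∃₂ λ g gs → rotate r B ≡ g ∷ gs
rotate-nonempty r {B = B} xu↭B with rotate r B | rotate-↭ r B
... | [] | []↭B = ⊥-elim (¬x∷xs↭[] (↭-trans xu↭B (↭-sym []↭B)))
... | g ∷ gs | _ = g , gs , refl

rotate-head-above : ∀ r B {g gs} → rotate r B ≡ g ∷ gs → 0 < #above r B → r < g
rotate-head-above r B eq _ with above r B | all-filter (r <?_) B
... | a ∷ _ | r<a ∷ _ = subst (r <_) (∷-injectiveˡ eq) r<a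

rotate-head∈ : ∀ r {x u B g gs} → x ∷ u ↭ B → rotate r B ≡ g ∷ gs → g < x → g ∈ u
rotate-head∈ r {B = B} xu↭B eq g<x =
  Any.tail (<⇒≢ g<x) (∈-resp-↭ (↭-sym xu↭B) (∈-resp-↭ (rotate-↭ r B) g∈rotate))
  where
  g∈rotate = subst (_ ∈_) (sym eq) (here refl)

segmentMaj-rotate-< : ∀ k t {B} → Linked _≤_ B →
                      segmentMaj (suc k) (rotate t B) t < suc k + length B
segmentMaj-rotate-< k t {B} B↗ = begin-strict
  segmentMaj (suc k) (rotate t B) t    ≤⟨ segmentMaj-rotate≤min (suc k) t B↗ ⟩
  minSegmentMaj (suc k) (#above t B)   <⟨ minSegmentMaj-< k (#above t B) ⟩
  suc k + #above t B                   ≤⟨ +-monoʳ-≤ (suc k) (length-filter (t <?_) B) ⟩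
  suc k + length B                     ∎
  where open ≤-Reasoning

segmentMaj-rotate≤ : ∀ p {s r u B} → u ↭ B → Linked _≤_ B → s ≤ r →
                     segmentMaj p (rotate r B) r ≤ segmentMaj p u s
segmentMaj-rotate≤ p {s} {r} {u} {B} u↭B B↗ s≤r = begin
  segmentMaj p (rotate r B) r     ≤⟨ segmentMaj-rotate≤min p r B↗ ⟩
  minSegmentMaj p (#above r B)    ≤⟨ minSegmentMaj-mono p (#above-antitone B s≤r) ⟩
  minSegmentMaj p (#above s B)    ≡⟨ cong (minSegmentMaj p) (#above-↭ s u↭B) ⟨
  minSegmentMaj p (#above s u)    ≤⟨ minSegmentMaj≤segmentMaj p s u ⟩
  segmentMaj p u s                ∎
  where open ≤-Reasoning

segmentMaj≤rotate⇒≡ : ∀ k {r u B} → u ↭ B → Linked _≤_ B →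
                      segmentMaj (suc k) u r ≤ segmentMaj (suc k) (rotate r B) r → u ≡ rotate r B
segmentMaj≤rotate⇒≡ k {r} {u} {B} u↭B B↗ maj≤ =
  isRotation⇒≡rotate u↭B B↗ (segmentMaj≤min⇒isRotation k r u (begin
    segmentMaj (suc k) u r              ≤⟨ maj≤ ⟩
    segmentMaj (suc k) (rotate r B) r   ≤⟨ segmentMaj-rotate≤min (suc k) r B↗ ⟩
    minSegmentMaj (suc k) (#above r B)  ≡⟨ cong (minSegmentMaj (suc k)) (#above-↭ r u↭B) ⟨
    minSegmentMaj (suc k) (#above r u)  ∎))
  where open ≤-Reasoning

segmentMaj-rotate-gap : ∀ p {s r x u B g gs} → x ∷ u ↭ B → Linked _≤_ B → s ≤ r →
                        rotate r B ≡ g ∷ gs → g < x →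
                        p + segmentMaj p (rotate r B) r ≤ segmentMaj p (x ∷ u) s
segmentMaj-rotate-gap p {s} {r} {x} {u} {B} {g} xu↭B B↗ s≤r eq g<x
  with #above r B | segmentMaj-rotate≤min p r B↗ | #above-antitone B s≤r | rotate-head-above r B eq
... | zero | G≤0 | _ | _ = begin
  p + segmentMaj p (rotate r B) r   ≤⟨ +-monoʳ-≤ p G≤0 ⟩
  p + 0                             ≡⟨ +-identityʳ p ⟩
  p                                 ≤⟨ inversion⇒p≤majFrom p (∈-++⁺ˡ g∈u) g<x ⟩
  segmentMaj p (x ∷ u) s            ∎
  where
  open ≤-Reasoning
  g∈u = rotate-head∈ r xu↭B eq g<x
... | suc c | G≤ | c<#s | r<g = begin
  p + segmentMaj p (rotate r B) r   ≤⟨ +-monoʳ-≤ p G≤ ⟩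
  p + (p + c)                       ≤⟨ +-monoʳ-≤ p (+-monoʳ-≤ p c≤#s) ⟩
  p + (p + #above s u)              ≤⟨ inversion-above⇒segmentMaj≥ p u s<g g<x g∈u ⟩
  segmentMaj p (x ∷ u) s            ∎
  where
  open ≤-Reasoning
  g∈u = rotate-head∈ r xu↭B eq g<x
  s<g = ≤-<-trans s≤r (r<g (s≤s z≤n))
  c≤#s : c ≤ #above s u
  c≤#s = s≤s⁻¹ (begin
    suc c                ≤⟨ c<#s ⟩
    #above s B           ≡⟨ #above-↭ s xu↭B ⟨
    #above s (x ∷ u)     ≡⟨ cong length (above-∷-accept u (<-trans s<g g<x)) ⟩
    suc (#above s u)     ∎)

_<ʰ_ : List ℕ → List ℕ → Set
(x ∷ _) <ʰ (y ∷ _) = x < y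
_ <ʰ _ = ⊥

record Beats (p : ℕ) (π v : List ℕ) : Set where
  field
    maj≤       : majFrom p π ≤ majFrom p v
    maj≤-head< : π <ʰ v → p + majFrom p π ≤ majFrom p v
    unique     : majFrom p v ≤ majFrom p π → v ≡ π

↭-head<⇒p≤majFrom : ∀ p {π u} → π ↭ u → π <ʰ u → p ≤ majFrom p u
↭-head<⇒p≤majFrom p {g ∷ _} {x ∷ _} π↭u g<x =
  inversion⇒p≤majFrom p (Any.tail (<⇒≢ g<x) (∈-resp-↭ π↭u (here refl))) g<x

beats-sorted : ∀ k {u B} → u ↭ B → Linked _≤_ B → Beats (suc k) B u
beats-sorted k {u} {B} u↭B B↗ = record
  { maj≤       = subst (_≤ majFrom (suc k) u) (sym B0) z≤n
  ; maj≤-head< = maj≤-head<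
  ; unique     = λ maj≤ → ↗↭↗⇒≡ (u↗ maj≤) B↗ u↭B
  }
  where
  open ≤-Reasoning
  B0 : majFrom (suc k) B ≡ 0
  B0 = sorted⇒majFrom≡0 (suc k) B↗
  u↗ : majFrom (suc k) u ≤ majFrom (suc k) B → Linked _≤_ u
  u↗ maj≤ = majFrom<p⇒sorted (suc k) u (s≤s (≤-trans maj≤ (≤-trans (≤-reflexive B0) z≤n)))
  maj≤-head< : B <ʰ u → suc k + majFrom (suc k) B ≤ majFrom (suc k) u
  maj≤-head< B<u = begin
    suc k + majFrom (suc k) B   ≡⟨ cong (suc k +_) B0 ⟩
    suc k + 0                   ≡⟨ +-identityʳ (suc k) ⟩
    suc k                       ≤⟨ ↭-head<⇒p≤majFrom (suc k) (↭-sym u↭B) B<u ⟩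
    majFrom (suc k) u           ∎

beats-rotate : ∀ k {x u B r rest s vs} → x ∷ u ↭ B → Linked _≤_ B →
               Beats (suc k + length B) (r ∷ rest) (s ∷ vs) →
               Beats (suc k) (rotate r B ++ r ∷ rest) (x ∷ u ++ s ∷ vs)
beats-rotate k {x} {u} {B} {r} {rest} {s} {vs} xu↭B B↗ tail = record
  { maj≤       = subst₂ _≤_ (sym π≡) (sym v≡) G+P≤H+V
  ; maj≤-head< = maj≤-head<
  ; unique     = λ maj≤ → optimal⇒≡ (subst₂ _≤_ v≡ π≡ maj≤)
  }
  where
  open Beats tail renaming (maj≤ to P≤V; maj≤-head< to P+q≤V; unique to tail-unique)
  p = suc k
  q = p + length B
  G = segmentMaj p (rotate r B) r
  H = segmentMaj p (x ∷ u) s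
  P = majFrom q (r ∷ rest)
  V = majFrom q (s ∷ vs)

  π≡ : majFrom p (rotate r B ++ r ∷ rest) ≡ G + P
  π≡ = trans (majFrom-++ p (rotate r B) r rest)
             (cong (λ n → G + majFrom (p + n) (r ∷ rest)) (↭-length (rotate-↭ r B)))
  v≡ : majFrom p (x ∷ u ++ s ∷ vs) ≡ H + V
  v≡ = trans (majFrom-++ p (x ∷ u) s vs)
             (cong (λ n → H + majFrom (p + n) (s ∷ vs)) (↭-length xu↭B))

  G+P<V : r < s → G + P < V
  G+P<V r<s = ≤-trans (+-monoˡ-< P (segmentMaj-rotate-< k r B↗)) (P+q≤V r<s)

  G+P≤H+V : G + P ≤ H + V
  G+P≤H+V with r <? s
  ... | yes r<s = ≤-trans (<⇒≤ (G+P<V r<s)) (m≤n+m V H)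
  ... | no r≮s = +-mono-≤ (segmentMaj-rotate≤ p xu↭B B↗ (≮⇒≥ r≮s)) P≤V

  maj≤-head< : (rotate r B ++ r ∷ rest) <ʰ (x ∷ u ++ s ∷ vs) →
               p + majFrom p (rotate r B ++ r ∷ rest) ≤ majFrom p (x ∷ u ++ s ∷ vs)
  maj≤-head< π<v with rotate-nonempty r xu↭B
  ... | g , gs , eq = subst₂ (λ a b → p + a ≤ b) (sym π≡) (sym v≡)
                        (gap (subst (λ ρ → (ρ ++ r ∷ rest) <ʰ (x ∷ u ++ s ∷ vs)) eq π<v))
    where
    gap : g < x → p + (G + P) ≤ H + V
    gap g<x with r <? s
    ... | yes r<s = +-mono-≤ (inversion⇒p≤majFrom p (∈-++⁺ˡ (rotate-head∈ r xu↭B eq g<x)) g<x)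
                              (<⇒≤ (G+P<V r<s))
    ... | no r≮s = subst (_≤ H + V) (+-assoc p G P)
                     (+-mono-≤ (segmentMaj-rotate-gap p xu↭B B↗ (≮⇒≥ r≮s) eq g<x) P≤V)

  optimal⇒≡ : H + V ≤ G + P → x ∷ u ++ s ∷ vs ≡ rotate r B ++ r ∷ rest
  optimal⇒≡ H+V≤G+P with r <? s
  ... | yes r<s = contradiction (≤-trans (m≤n+m V H) H+V≤G+P) (<⇒≱ (G+P<V r<s))
  ... | no r≮s with +-≤-squeeze (segmentMaj-rotate≤ p xu↭B B↗ (≮⇒≥ r≮s)) P≤V H+V≤G+P
  ...   | H≤G , V≤P with tail-unique V≤P
  ...     | refl = cong (_++ s ∷ vs) (segmentMaj≤rotate⇒≡ k xu↭B B↗ H≤G)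

πσ-≢[] : ∀ {B Bs} → All (_≢ []) (B ∷ Bs) → πσ (B ∷ Bs) ≢ []
πσ-≢[] {B} {Bs} (B≢[] ∷ _) with πσ Bs
... | [] = B≢[]
... | r ∷ rest = (λ ()) ∘ ++-conicalʳ (rotate r B) (r ∷ rest)

πσ-∈S : ∀ σ → πσ σ ∈S σ
πσ-∈S [] = [] , [] , refl
πσ-∈S (B ∷ Bs) with πσ Bs | πσ-∈S Bs
... | [] | ws , ws↭Bs , []≡ws =
  B ∷ ws , ↭-refl ∷ ws↭Bs , sym (trans (cong (B ++_) (sym []≡ws)) (++-identityʳ B))
... | r ∷ rest | ws , ws↭Bs , π≡ws =
  rotate r B ∷ ws , rotate-↭ r B ∷ ws↭Bs , cong (rotate r B ++_) π≡ws

-- Positions start at suc k: at position 0 a descent is free and uniqueness fails.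
beats-πσ : ∀ k {ws Bs} → Pointwise _↭_ ws Bs → All (Linked _≤_) Bs → All (_≢ []) Bs →
           Beats (suc k) (πσ Bs) (concat ws)
beats-πσ k [] [] [] = record { maj≤ = z≤n ; maj≤-head< = λ () ; unique = λ _ → refl }
beats-πσ k (u↭B ∷ []) (B↗ ∷ []) _ =
  subst (Beats (suc k) _) (sym (++-identityʳ _)) (beats-sorted k u↭B B↗)
beats-πσ k {[] ∷ _} (u↭B ∷ _ ∷ _) _ (B≢[] ∷ _) = ⊥-elim (B≢[] (↭-empty-inv (↭-sym u↭B)))
beats-πσ k {_ ∷ [] ∷ _} (_ ∷ u↭C ∷ _) _ (_ ∷ C≢[] ∷ _) = ⊥-elim (C≢[] (↭-empty-inv (↭-sym u↭C)))
beats-πσ k {(x ∷ u) ∷ (y ∷ u′) ∷ ws} {B ∷ C ∷ Cs} (xu↭B ∷ ws↭Bs) (B↗ ∷ Bs↗) (_ ∷ Bs≢[])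
  with πσ (C ∷ Cs) | beats-πσ (k + length B) ws↭Bs Bs↗ Bs≢[] | πσ-≢[] Bs≢[]
... | [] | _ | π≢[] = ⊥-elim (π≢[] refl)
... | r ∷ rest | tail | _ = beats-rotate k xu↭B B↗ tail

lemma2p2 : (n : ℕ) (σ : List Block) → IsOSP n σ →
    (πσ σ ∈S σ)
    × ((w : List ℕ) → w ∈S σ → maj (πσ σ) ≤ maj w)
    × ((w : List ℕ) → w ∈S σ → maj w ≡ maj (πσ σ) → w ≡ πσ σ)
lemma2p2 n σ osp =
  πσ-∈S σ ,
  (λ w w∈Sσ → Beats.maj≤ (beats w∈Sσ)) ,
  (λ w w∈Sσ maj≡ → Beats.unique (beats w∈Sσ) (≤-reflexive maj≡))
  where
  beats : ∀ {w} → w ∈S σ → Beats 1 (πσ σ) w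
  beats (ws , ws↭σ , refl) =
    beats-πσ 0 ws↭σ (All.map (Linked.map <⇒≤) (IsOSP.sorted osp)) (IsOSP.nonempty osp)
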